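{- For a non-empty partition $\pi$ let $\pi_1$ be its largest part, $\ell(\pi)$ its number of parts and $\Gamma(\pi)=\pi_1+\ell(\pi)-1$. Let $\mathcal{P}$, $\mathcal{D}$, $\mathcal{O}$ denote respectively the sets of all non-empty partitions, non-empty partitions into distinct parts, and non-empty partitions into odd parts. Then, as formal power series, $$\sum_{\pi\in\mathcal{P}}x^{\pi_1}y^{\ell(\pi)}q^{\Gamma(\pi)}=\frac{xyq}{1-(xq+yq)},\qquad \sum_{\pi\in\mathcal{D}}x^{\pi_1}y^{\ell(\pi)}q^{\Gamma(\pi)}=\frac{xyq}{1-(xq+xyq^2)},$$ $$\sum_{\pi\in\mathcal{O}}x^{\pi_1}y^{\ell(\pi)}q^{\Gamma(\pi)}=\frac{xyq}{1-(yq+x^2q^2)}.$$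
   Context: Partitions are finite non-increasing sequences of positive integers; the empty partition is excluded. $\Gamma(\pi)=\pi_1+\ell(\pi)-1$ is the length of the largest hook of $\pi$. -}

module Defs where

open import Data.Nat using (ℕ; zero; suc; _∸_; _⊔_; _≡ᵇ_; _≤ᵇ_; _<ᵇ_; _%_)
open import Data.Bool using (Bool; true; false; _∧_; if_then_else_)
open import Data.List using (List; []; _∷_; length; map; concatMap; upTo; foldr)
open import Data.Integer as ℤ using (ℤ; +_)
open import Relation.Binary.PropositionalEquality using (_≡_)

nonincreasing : List ℕ → Bool
nonincreasing []            = true
nonincreasing (x ∷ [])      = true
nonincreasing (x ∷ y ∷ r)   = (y ≤ᵇ x) ∧ nonincreasing (y ∷ r)

strictlyDecreasing : List ℕ → Bool
strictlyDecreasing []          = true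
strictlyDecreasing (x ∷ [])    = true
strictlyDecreasing (x ∷ y ∷ r) = (y <ᵇ x) ∧ strictlyDecreasing (y ∷ r)

nonEmpty : List ℕ → Bool
nonEmpty []      = false
nonEmpty (_ ∷ _) = true

allB : (ℕ → Bool) → List ℕ → Bool
allB p []       = true
allB p (x ∷ xs) = p x ∧ allB p xs

allPositive : List ℕ → Bool
allPositive = allB (λ n → 1 ≤ᵇ n)

isPartition : List ℕ → Bool
isPartition π = nonEmpty π ∧ allPositive π ∧ nonincreasing π

isDistinctPartition : List ℕ → Bool
isDistinctPartition π = isPartition π ∧ strictlyDecreasing π

isOddPartition : List ℕ → Bool
isOddPartition π = isPartition π ∧ allB (λ n → (n % 2) ≡ᵇ 1) π

largestPart : List ℕ → ℕ
largestPart = foldr _⊔_ 0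

numParts : List ℕ → ℕ
numParts = length

Γ : List ℕ → ℕ
Γ π = largestPart π Data.Nat.+ numParts π ∸ 1

-- Formal power series in x, y, q with integer coefficients:
-- s i j k is the coefficient of x^i y^j q^k.

Series : Set
Series = ℕ → ℕ → ℕ → ℤ

_≈_ : Series → Series → Set
f ≈ g = ∀ i j k → f i j k ≡ g i j k

infix 4 _≈_

sumTo : ℕ → (ℕ → ℤ) → ℤ
sumTo zero    h = h zero
sumTo (suc n) h = sumTo n h ℤ.+ h (suc n)

_⊕_ : Series → Series → Series
(f ⊕ g) i j k = f i j k ℤ.+ g i j k

_⊖_ : Series → Series → Series
(f ⊖ g) i j k = f i j k ℤ.- g i j k

_⊛_ : Series → Series → Series
(f ⊛ g) i j k =
  sumTo i λ a → sumTo j λ b → sumTo k λ c →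
    f a b c ℤ.* g (i ∸ a) (j ∸ b) (k ∸ c)

infixl 7 _⊛_
infixl 6 _⊕_ _⊖_

mono : ℕ → ℕ → ℕ → Series
mono a b c i j k = if (i ≡ᵇ a) ∧ (j ≡ᵇ b) ∧ (k ≡ᵇ c) then + 1 else + 0

-- The coefficient of x^i y^j q^k is the number of π ∈ C with π₁ = i,
-- ℓ(π) = j, Γ(π) = k. Every such π is a list of length j with entries
-- in {0,…,i}, so it suffices to count within that finite list.

boundedLists : ℕ → ℕ → List (List ℕ)
boundedLists a zero    = [] ∷ []
boundedLists a (suc b) = concatMap (λ x → map (x ∷_) (boundedLists a b)) (upTo (suc a))

countB : {A : Set} → (A → Bool) → List A → ℕ
countB p []       = 0
countB p (x ∷ xs) = if p x then suc (countB p xs) else countB p xs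

genSeries : (List ℕ → Bool) → Series
genSeries C i j k =
  + countB (λ π → C π ∧ (largestPart π ≡ᵇ i) ∧ (numParts π ≡ᵇ j) ∧ (Γ π ≡ᵇ k))
           (boundedLists i j)

module Submission where

-- The coefficient of x^i y^j q^k in Σ_{π ∈ C} x^{π₁} y^{ℓ(π)} q^{Γ(π)} counts the
-- π ∈ C with π₁ = i, ℓ(π) = j, and vanishes unless k = i + j − 1: the series is a
-- two-variable table φ placed on this "hook diagonal" (lift).  Multiplying such a
-- series by x^d y^e q^(d+e) only translates the table (lift-translate), so each
-- functional equation G·(1 − x^a y^b q^(a+b) − x^c y^d q^(c+d)) = xyq is equivalent
-- to the table recurrence φ i j = φ(i−a, j−b) + φ(i−c, j−d) + [i = j = 1]
-- (functional-equation).  To compute the tables, a partition is read as a chain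
-- x ∷ r whose entries satisfy a predicate E and whose consecutive entries satisfy
-- a relation R; the chains headed by x number
--   chains x (n+1) = Σ_{y ≤ x, R y x} chains y n,
-- and peeling off the top terms of this sum gives the recurrence for each class.

open import Algebra.Bundles using (CommutativeMonoid)
open import Data.Bool using (Bool; true; false; _∧_; if_then_else_; T)
open import Data.Bool.Properties using (∧-zeroʳ; ∧-identityʳ; ∧-commutativeMonoid)
open import Data.Empty using (⊥-elim)
open import Data.Integer as ℤ using (ℤ; +_; -_)
import Data.Integer.Properties as ℤₚ
open import Data.List using (List; []; _∷_; [_]; _++_; length; map; concatMap; upTo)
open import Data.List.Properties using (upTo-∷ʳ; map-++)
open import Data.Nat using (ℕ; zero; suc; _+_; _∸_; _⊔_; _≤_; _<_; _≡ᵇ_; _≤ᵇ_; _<ᵇ_; _%_; _≤?_; z≤n; s≤s)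
open import Data.Nat.DivMod using ([m+n]%n≡m%n)
open import Data.Nat.ListAction using (sum)
open import Data.Nat.ListAction.Properties using (sum-++)
open import Data.Nat.Properties
open import Data.Product using (_×_; _,_)
open import Data.Sum using (inj₁; inj₂)
open import Data.Unit using (tt)
open import Relation.Binary.PropositionalEquality hiding ([_])
open import Relation.Nullary using (¬_; yes; no)

open import Defs

open import Algebra.Properties.CommutativeSemigroup ℤₚ.+-commutativeSemigroup
  using () renaming (interchange to +ℤ-interchange)
open import Algebra.Properties.CommutativeSemigroup +-commutativeSemigroup
  using () renaming (interchange to +-interchange)
open import Algebra.Properties.CommutativeSemigroup
  (CommutativeMonoid.commutativeSemigroup ∧-commutativeMonoid)
  using () renaming (interchange to ∧-interchange)

open ≡-Reasoning

if-same : ∀ {A : Set} (b : Bool) {x : A} → (if b then x else x) ≡ x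
if-same true  = refl
if-same false = refl

T⇒≡true : ∀ {b} → T b → b ≡ true
T⇒≡true {true} _ = refl

≡true⇒T : ∀ {b} → b ≡ true → T b
≡true⇒T refl = tt

∧-true : ∀ a b → a ∧ b ≡ true → a ≡ true × b ≡ true
∧-true true true _ = refl , refl

≡ᵇ-refl : ∀ n → (n ≡ᵇ n) ≡ true
≡ᵇ-refl n = T⇒≡true (≡⇒≡ᵇ n n refl)

≡ᵇ-sound : ∀ m n → (m ≡ᵇ n) ≡ true → m ≡ n
≡ᵇ-sound m n eq = ≡ᵇ⇒≡ m n (≡true⇒T eq)

≡ᵇ-≢ : ∀ {m n} → m ≢ n → (m ≡ᵇ n) ≡ false
≡ᵇ-≢ {m} {n} m≢n with m ≡ᵇ n in eq
... | true  = ⊥-elim (m≢n (≡ᵇ-sound m n eq))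
... | false = refl

≤ᵇ-sound : ∀ {m n} → (m ≤ᵇ n) ≡ true → m ≤ n
≤ᵇ-sound {m} {n} eq = ≤ᵇ⇒≤ m n (≡true⇒T eq)

≤ᵇ-complete : ∀ {m n} → m ≤ n → (m ≤ᵇ n) ≡ true
≤ᵇ-complete m≤n = T⇒≡true (≤⇒≤ᵇ m≤n)

≤ᵇ-≰ : ∀ {m n} → ¬ m ≤ n → (m ≤ᵇ n) ≡ false
≤ᵇ-≰ {m} {n} m≰n with m ≤ᵇ n in eq
... | true  = ⊥-elim (m≰n (≤ᵇ-sound eq))
... | false = refl

≤ᵇ-suc : ∀ m n → (suc m ≤ᵇ suc n) ≡ (m ≤ᵇ n)
≤ᵇ-suc zero    n = refl
≤ᵇ-suc (suc m) n = refl

<ᵇ-irrefl : ∀ n → (n <ᵇ n) ≡ false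
<ᵇ-irrefl zero    = refl
<ᵇ-irrefl (suc n) = <ᵇ-irrefl n

sumTo-cong : ∀ n {g h : ℕ → ℤ} → (∀ t → g t ≡ h t) → sumTo n g ≡ sumTo n h
sumTo-cong zero    g≗h = g≗h zero
sumTo-cong (suc n) g≗h = cong₂ ℤ._+_ (sumTo-cong n g≗h) (g≗h (suc n))

sumTo-+ : ∀ n (g h : ℕ → ℤ) → sumTo n (λ t → g t ℤ.+ h t) ≡ sumTo n g ℤ.+ sumTo n h
sumTo-+ zero    g h = refl
sumTo-+ (suc n) g h = begin
  sumTo n (λ t → g t ℤ.+ h t) ℤ.+ (g (suc n) ℤ.+ h (suc n))
    ≡⟨ cong (ℤ._+ (g (suc n) ℤ.+ h (suc n))) (sumTo-+ n g h) ⟩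
  (sumTo n g ℤ.+ sumTo n h) ℤ.+ (g (suc n) ℤ.+ h (suc n))
    ≡⟨ +ℤ-interchange (sumTo n g) (sumTo n h) (g (suc n)) (h (suc n)) ⟩
  sumTo (suc n) g ℤ.+ sumTo (suc n) h ∎

sumTo-neg : ∀ n (h : ℕ → ℤ) → sumTo n (λ t → - h t) ≡ - sumTo n h
sumTo-neg zero    h = refl
sumTo-neg (suc n) h = trans (cong (ℤ._+ - h (suc n)) (sumTo-neg n h))
                            (sym (ℤₚ.neg-distrib-+ (sumTo n h) (h (suc n))))

sumTo-zero : ∀ n (h : ℕ → ℤ) → (∀ t → t ≤ n → h t ≡ + 0) → sumTo n h ≡ + 0
sumTo-zero zero    h h≡0 = h≡0 zero z≤n
sumTo-zero (suc n) h h≡0 =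
  cong₂ ℤ._+_ (sumTo-zero n h (λ t t≤n → h≡0 t (m≤n⇒m≤1+n t≤n))) (h≡0 (suc n) ≤-refl)

sumTo-single : ∀ n {t} (h : ℕ → ℤ) → t ≤ n → (∀ a → a ≤ n → a ≢ t → h a ≡ + 0) →
  sumTo n h ≡ h t
sumTo-single zero    h z≤n _ = refl
sumTo-single (suc n) {t} h t≤1+n off with m≤n⇒m<n∨m≡n t≤1+n
... | inj₂ refl = trans (cong (ℤ._+ h (suc n)) (sumTo-zero n h (λ a a≤n →
                    off a (m≤n⇒m≤1+n a≤n) (<⇒≢ (s≤s a≤n))))) (ℤₚ.+-identityˡ (h (suc n)))
... | inj₁ (s≤s t≤n) = trans (cong₂ ℤ._+_ (sumTo-single n h t≤n (λ a a≤n → off a (m≤n⇒m≤1+n a≤n)))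
                                          (off (suc n) ≤-refl (λ e → <⇒≢ (s≤s t≤n) (sym e))))
                             (ℤₚ.+-identityʳ (h t))

gate-closed : ∀ (p : Bool → Bool) → p false ≡ false → (H : ℕ → ℤ) → ∀ {a b} → b ≡ false →
  (if p b then H a else + 0) ≡ + 0
gate-closed p p-false H refl rewrite p-false = refl

sumTo-select : ∀ n d (p : Bool → Bool) → p false ≡ false → (H : ℕ → ℤ) →
  sumTo n (λ a → if p (n ∸ a ≡ᵇ d) then H a else + 0) ≡ (if p (d ≤ᵇ n) then H (n ∸ d) else + 0)
sumTo-select n d p p-false H with d ≤? n
... | yes d≤n = begin
  sumTo n (λ a → if p (n ∸ a ≡ᵇ d) then H a else + 0)
    ≡⟨ sumTo-single n _ (m∸n≤m n d) off ⟩
  (if p (n ∸ (n ∸ d) ≡ᵇ d) then H (n ∸ d) else + 0)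
    ≡⟨ cong (λ b → if p b then H (n ∸ d) else + 0)
            (trans (cong (_≡ᵇ d) (m∸[m∸n]≡n d≤n)) (trans (≡ᵇ-refl d) (sym (≤ᵇ-complete d≤n)))) ⟩
  (if p (d ≤ᵇ n) then H (n ∸ d) else + 0) ∎
  where
  off : ∀ a → a ≤ n → a ≢ n ∸ d → (if p (n ∸ a ≡ᵇ d) then H a else + 0) ≡ + 0
  off a a≤n a≢ = gate-closed p p-false H
    (≡ᵇ-≢ {n ∸ a} {d} (λ e → a≢ (sym (trans (cong (n ∸_) (sym e)) (m∸[m∸n]≡n a≤n)))))
... | no d≰n rewrite ≤ᵇ-≰ d≰n | p-false = sumTo-zero n _ (λ a _ →
  gate-closed p p-false H (≡ᵇ-≢ {n ∸ a} {d} (λ e → d≰n (subst (_≤ n) e (m∸n≤m n a)))))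

sum3 : ℕ → ℕ → ℕ → (ℕ → ℕ → ℕ → ℤ) → ℤ
sum3 i j k F = sumTo i λ a → sumTo j λ b → sumTo k λ c → F a b c

sum3-cong : ∀ i j k {F F′ : ℕ → ℕ → ℕ → ℤ} → (∀ a b c → F a b c ≡ F′ a b c) →
  sum3 i j k F ≡ sum3 i j k F′
sum3-cong i j k F≗F′ = sumTo-cong i λ a → sumTo-cong j λ b → sumTo-cong k λ c → F≗F′ a b c

sum3-+ : ∀ i j k (F F′ : ℕ → ℕ → ℕ → ℤ) →
  sum3 i j k (λ a b c → F a b c ℤ.+ F′ a b c) ≡ sum3 i j k F ℤ.+ sum3 i j k F′
sum3-+ i j k F F′ =
  trans (sumTo-cong i λ a → trans (sumTo-cong j λ b → sumTo-+ k _ _) (sumTo-+ j _ _)) (sumTo-+ i _ _)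

sum3-neg : ∀ i j k (F : ℕ → ℕ → ℕ → ℤ) → sum3 i j k (λ a b c → - F a b c) ≡ - sum3 i j k F
sum3-neg i j k F =
  trans (sumTo-cong i λ a → trans (sumTo-cong j λ b → sumTo-neg k _) (sumTo-neg j _)) (sumTo-neg i _)

⊛-distribˡ-⊕ : ∀ f g h → f ⊛ (g ⊕ h) ≈ f ⊛ g ⊕ f ⊛ h
⊛-distribˡ-⊕ f g h i j k =
  trans (sum3-cong i j k λ a b c → ℤₚ.*-distribˡ-+ (f a b c) _ _) (sum3-+ i j k _ _)

⊛-distribˡ-⊖ : ∀ f g h → f ⊛ (g ⊖ h) ≈ f ⊛ g ⊖ f ⊛ h
⊛-distribˡ-⊖ f g h i j k = begin
  sum3 i j k (λ a b c → f a b c ℤ.* (g′ a b c ℤ.- h′ a b c))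
    ≡⟨ sum3-cong i j k (λ a b c → trans (ℤₚ.*-distribˡ-+ (f a b c) _ _)
                        (cong (λ z → f a b c ℤ.* g′ a b c ℤ.+ z) (sym (ℤₚ.neg-distribʳ-* (f a b c) _)))) ⟩
  sum3 i j k (λ a b c → f a b c ℤ.* g′ a b c ℤ.+ - (f a b c ℤ.* h′ a b c))
    ≡⟨ sum3-+ i j k _ _ ⟩
  (f ⊛ g) i j k ℤ.+ sum3 i j k (λ a b c → - (f a b c ℤ.* h′ a b c))
    ≡⟨ cong (λ z → (f ⊛ g) i j k ℤ.+ z) (sum3-neg i j k _) ⟩
  (f ⊛ g ⊖ f ⊛ h) i j k ∎
  where
  g′ h′ : ℕ → ℕ → ℕ → ℤ
  g′ a b c = g (i ∸ a) (j ∸ b) (k ∸ c)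
  h′ a b c = h (i ∸ a) (j ∸ b) (k ∸ c)

⊛-one-minus : ∀ f g h e → f ⊛ (g ⊖ (h ⊕ e)) ≈ f ⊛ g ⊖ (f ⊛ h ⊕ f ⊛ e)
⊛-one-minus f g h e i j k =
  trans (⊛-distribˡ-⊖ f g (h ⊕ e) i j k) (cong (λ z → (f ⊛ g) i j k ℤ.- z) (⊛-distribˡ-⊕ f h e i j k))

translate : ℕ → ℕ → ℕ → Series → Series
translate d e g f i j k =
  if (d ≤ᵇ i) ∧ (e ≤ᵇ j) ∧ (g ≤ᵇ k) then f (i ∸ d) (j ∸ e) (k ∸ g) else + 0

*-indicator : ∀ x b → x ℤ.* (if b then + 1 else + 0) ≡ (if b then x else + 0)
*-indicator x true  = ℤₚ.*-identityʳ x
*-indicator x false = ℤₚ.*-zeroʳ x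

-- Each of the three sums collapses to the single index where the monomial is hit.
⊛-mono : ∀ f d e g → f ⊛ mono d e g ≈ translate d e g f
⊛-mono f d e g i j k = begin
  sum3 i j k (λ a b c → f a b c ℤ.* mono d e g (i ∸ a) (j ∸ b) (k ∸ c))
    ≡⟨ sum3-cong i j k (λ a b c → *-indicator (f a b c) _) ⟩
  sum3 i j k (λ a b c → if (i ∸ a ≡ᵇ d) ∧ (j ∸ b ≡ᵇ e) ∧ (k ∸ c ≡ᵇ g) then f a b c else + 0)
    ≡⟨ sumTo-cong i (λ a → sumTo-cong j λ b →
         sumTo-select k g (λ z → (i ∸ a ≡ᵇ d) ∧ (j ∸ b ≡ᵇ e) ∧ z)
           (trans (cong ((i ∸ a ≡ᵇ d) ∧_) (∧-zeroʳ _)) (∧-zeroʳ _)) (f a b)) ⟩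
  sumTo i (λ a → sumTo j λ b → if (i ∸ a ≡ᵇ d) ∧ (j ∸ b ≡ᵇ e) ∧ (g ≤ᵇ k) then f a b (k ∸ g) else + 0)
    ≡⟨ sumTo-cong i (λ a → sumTo-select j e (λ z → (i ∸ a ≡ᵇ d) ∧ z ∧ (g ≤ᵇ k)) (∧-zeroʳ _)
                                        (λ b → f a b (k ∸ g))) ⟩
  sumTo i (λ a → if (i ∸ a ≡ᵇ d) ∧ (e ≤ᵇ j) ∧ (g ≤ᵇ k) then f a (j ∸ e) (k ∸ g) else + 0)
    ≡⟨ sumTo-select i d (λ z → z ∧ (e ≤ᵇ j) ∧ (g ≤ᵇ k)) refl (λ a → f a (j ∸ e) (k ∸ g)) ⟩
  translate d e g f i j k ∎

lift : (ℕ → ℕ → ℕ) → Series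
lift φ i j k = + (if i + j ∸ 1 ≡ᵇ k then φ i j else 0)

shift : ℕ → ℕ → (ℕ → ℕ → ℕ) → ℕ → ℕ → ℕ
shift d e φ i j = if (d ≤ᵇ i) ∧ (e ≤ᵇ j) then φ (i ∸ d) (j ∸ e) else 0

unit : ℕ → ℕ → ℕ
unit i j = if (i ≡ᵇ 1) ∧ (j ≡ᵇ 1) then 1 else 0

diagonal-translate : ∀ m s k (x : ℕ) →
  (if m ≤ᵇ k then + (if s ≡ᵇ k ∸ m then x else 0) else + 0) ≡ + (if m + s ≡ᵇ k then x else 0)
diagonal-translate zero    s k       x = refl
diagonal-translate (suc m) s zero    x = refl
diagonal-translate (suc m) s (suc k) x rewrite ≤ᵇ-suc m k = diagonal-translate m s k x

-- The same for a table entry φ a b; the entry φ 0 0, which lift does not keep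
-- on the diagonal, has to vanish.
lift-translate-entry : ∀ φ → φ 0 0 ≡ 0 → ∀ m a b k →
  (if m ≤ᵇ k then lift φ a b (k ∸ m) else + 0) ≡ + (if m + (a + b) ∸ 1 ≡ᵇ k then φ a b else 0)
lift-translate-entry φ φ00 m zero zero k rewrite φ00 =
  trans (cong (λ z → if m ≤ᵇ k then + z else + 0) (if-same (0 ≡ᵇ k ∸ m)))
        (trans (if-same (m ≤ᵇ k)) (cong +_ (sym (if-same (m + 0 ∸ 1 ≡ᵇ k)))))
lift-translate-entry φ φ00 m zero (suc b) k rewrite +-suc m b =
  diagonal-translate m b k (φ 0 (suc b))
lift-translate-entry φ φ00 m (suc a) b k rewrite +-suc m (a + b) =
  diagonal-translate m (a + b) k (φ (suc a) b)

degrees-add : ∀ {d e i j} → d ≤ i → e ≤ j → d + e + (i ∸ d + (j ∸ e)) ≡ i + j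
degrees-add {d} {e} {i} {j} d≤i e≤j =
  trans (+-interchange d e (i ∸ d) (j ∸ e)) (cong₂ _+_ (m+[n∸m]≡n d≤i) (m+[n∸m]≡n e≤j))

lift-translate : ∀ φ → φ 0 0 ≡ 0 → ∀ d e → translate d e (d + e) (lift φ) ≈ lift (shift d e φ)
lift-translate φ φ00 d e i j k with d ≤ᵇ i in d≤i | e ≤ᵇ j in e≤j
... | false | _     = cong +_ (sym (if-same (i + j ∸ 1 ≡ᵇ k)))
... | true  | false = cong +_ (sym (if-same (i + j ∸ 1 ≡ᵇ k)))
... | true  | true  = begin
  (if d + e ≤ᵇ k then lift φ (i ∸ d) (j ∸ e) (k ∸ (d + e)) else + 0)
    ≡⟨ lift-translate-entry φ φ00 (d + e) (i ∸ d) (j ∸ e) k ⟩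
  + (if d + e + (i ∸ d + (j ∸ e)) ∸ 1 ≡ᵇ k then φ (i ∸ d) (j ∸ e) else 0)
    ≡⟨ cong (λ n → + (if n ∸ 1 ≡ᵇ k then φ (i ∸ d) (j ∸ e) else 0))
            (degrees-add {d} {e} {i} {j} (≤ᵇ-sound d≤i) (≤ᵇ-sound e≤j)) ⟩
  + (if i + j ∸ 1 ≡ᵇ k then φ (i ∸ d) (j ∸ e) else 0) ∎

pos-cancel : ∀ x y z → + (x + y + z) ℤ.- (+ x ℤ.+ + y) ≡ + z
pos-cancel x y z = begin
  + (x + y + z) ℤ.- (+ x ℤ.+ + y)  ≡⟨ cong (λ w → + (x + y + z) ℤ.- w) (sym (ℤₚ.pos-+ x y)) ⟩
  + (x + y + z) ℤ.- + (x + y)      ≡⟨ ℤₚ.[+m]-[+n]≡m⊖n (x + y + z) (x + y) ⟩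
  (x + y + z) ℤ.⊖ (x + y)          ≡⟨ ℤₚ.⊖-≥ (m≤m+n (x + y) z) ⟩
  + (x + y + z ∸ (x + y))          ≡⟨ cong +_ (m+n∸m≡n (x + y) z) ⟩
  + z ∎

lift-cancel : ∀ φ ψ χ ω → (∀ i j → φ i j ≡ ψ i j + χ i j + ω i j) →
  lift φ ⊖ (lift ψ ⊕ lift χ) ≈ lift ω
lift-cancel φ ψ χ ω φ≡ i j k with i + j ∸ 1 ≡ᵇ k
... | false = refl
... | true  rewrite φ≡ i j = pos-cancel (ψ i j) (χ i j) (ω i j)

lift-unit : lift unit ≈ mono 1 1 1
lift-unit zero                j                   k = cong +_ (if-same (j ∸ 1 ≡ᵇ k))
lift-unit (suc (suc i))       j                   k = cong +_ (if-same (suc (suc i) + j ∸ 1 ≡ᵇ k))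
lift-unit (suc zero)          zero                k = cong +_ (if-same (0 ≡ᵇ k))
lift-unit (suc zero)          (suc (suc j))       k = cong +_ (if-same (suc (suc j) ≡ᵇ k))
lift-unit (suc zero)          (suc zero)          zero          = refl
lift-unit (suc zero)          (suc zero)          (suc zero)    = refl
lift-unit (suc zero)          (suc zero)          (suc (suc k)) = refl

RecurrenceAt : ℕ → ℕ → ℕ → ℕ → (ℕ → ℕ → ℕ) → ℕ → ℕ → Set
RecurrenceAt a b c d φ i j = φ i j ≡ shift a b φ i j + shift c d φ i j + unit i j

functional-equation : ∀ (G : Series) φ a b c d → G ≈ lift φ → φ 0 0 ≡ 0 →
  (∀ i j → RecurrenceAt a b c d φ i j) →
  G ⊛ (mono 0 0 0 ⊖ (mono a b (a + b) ⊕ mono c d (c + d))) ≈ mono 1 1 1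
functional-equation G φ a b c d G≈φ φ00 recurrence i j k = begin
  (G ⊛ (mono 0 0 0 ⊖ (mono a b (a + b) ⊕ mono c d (c + d)))) i j k
    ≡⟨ ⊛-one-minus G (mono 0 0 0) (mono a b (a + b)) (mono c d (c + d)) i j k ⟩
  (G ⊛ mono 0 0 0) i j k ℤ.- ((G ⊛ mono a b (a + b)) i j k ℤ.+ (G ⊛ mono c d (c + d)) i j k)
    ≡⟨ cong₂ ℤ._-_ (times-monomial 0 0) (cong₂ ℤ._+_ (times-monomial a b) (times-monomial c d)) ⟩
  lift φ i j k ℤ.- (lift (shift a b φ) i j k ℤ.+ lift (shift c d φ) i j k)
    ≡⟨ lift-cancel φ (shift a b φ) (shift c d φ) unit recurrence i j k ⟩
  lift unit i j k
    ≡⟨ lift-unit i j k ⟩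
  mono 1 1 1 i j k ∎
  where
  times-monomial : ∀ d e → (G ⊛ mono d e (d + e)) i j k ≡ lift (shift d e φ) i j k
  times-monomial d e = begin
    (G ⊛ mono d e (d + e)) i j k          ≡⟨ ⊛-mono G d e (d + e) i j k ⟩
    translate d e (d + e) G i j k
      ≡⟨ cong (λ z → if (d ≤ᵇ i) ∧ (e ≤ᵇ j) ∧ (d + e ≤ᵇ k) then z else + 0)
              (G≈φ (i ∸ d) (j ∸ e) (k ∸ (d + e))) ⟩
    translate d e (d + e) (lift φ) i j k  ≡⟨ lift-translate φ φ00 d e i j k ⟩
    lift (shift d e φ) i j k ∎

shift-axisˣ : ∀ φ d e → (∀ j → φ 0 j ≡ 0) → ∀ j → shift d e φ 0 j ≡ 0
shift-axisˣ φ d e φ0 j =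
  trans (cong (λ n → if (d ≤ᵇ 0) ∧ (e ≤ᵇ j) then n else 0)
              (trans (cong (λ i → φ i (j ∸ e)) (0∸n≡0 d)) (φ0 (j ∸ e))))
        (if-same ((d ≤ᵇ 0) ∧ (e ≤ᵇ j)))

shift-axisʸ : ∀ φ d e → (∀ i → φ i 0 ≡ 0) → ∀ i → shift d e φ i 0 ≡ 0
shift-axisʸ φ d e φ0 i =
  trans (cong (λ n → if (d ≤ᵇ i) ∧ (e ≤ᵇ 0) then n else 0)
              (trans (cong (φ (i ∸ d)) (0∸n≡0 e)) (φ0 (i ∸ d))))
        (if-same ((d ≤ᵇ i) ∧ (e ≤ᵇ 0)))

recurrence-from-interior : ∀ {a b c d φ} → (∀ j → φ 0 j ≡ 0) → (∀ i → φ i 0 ≡ 0) →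
  (∀ i j → RecurrenceAt a b c d φ (suc i) (suc j)) → ∀ i j → RecurrenceAt a b c d φ i j
recurrence-from-interior {a} {b} {c} {d} {φ} φ0 _ _ zero j =
  trans (φ0 j) (sym (cong₂ (λ u v → u + v + 0) (shift-axisˣ φ a b φ0 j) (shift-axisˣ φ c d φ0 j)))
recurrence-from-interior {a} {b} {c} {d} {φ} _ φ0 _ (suc i) zero = sym (begin
  shift a b φ (suc i) 0 + shift c d φ (suc i) 0 + unit (suc i) 0
    ≡⟨ cong₂ (λ u v → u + v + unit (suc i) 0)
             (shift-axisʸ φ a b φ0 (suc i)) (shift-axisʸ φ c d φ0 (suc i)) ⟩
  unit (suc i) 0
    ≡⟨ cong (λ t → if t then 1 else 0) (∧-zeroʳ (suc i ≡ᵇ 1)) ⟩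
  0
    ≡⟨ sym (φ0 (suc i)) ⟩
  φ (suc i) 0 ∎)
recurrence-from-interior _ _ interior (suc i) (suc j) = interior i j

sumℕ : ℕ → (ℕ → ℕ) → ℕ
sumℕ zero    h = h 0
sumℕ (suc m) h = sumℕ m h + h (suc m)

sumℕ-cong : ∀ m {g h : ℕ → ℕ} → (∀ y → y ≤ m → g y ≡ h y) → sumℕ m g ≡ sumℕ m h
sumℕ-cong zero    g≗h = g≗h 0 z≤n
sumℕ-cong (suc m) g≗h =
  cong₂ _+_ (sumℕ-cong m (λ y y≤m → g≗h y (m≤n⇒m≤1+n y≤m))) (g≗h (suc m) ≤-refl)

sumℕ-zero : ∀ m (g : ℕ → ℕ) → (∀ y → y ≤ m → g y ≡ 0) → sumℕ m g ≡ 0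
sumℕ-zero zero    g g≡0 = g≡0 0 z≤n
sumℕ-zero (suc m) g g≡0 =
  cong₂ _+_ (sumℕ-zero m g (λ y y≤m → g≡0 y (m≤n⇒m≤1+n y≤m))) (g≡0 (suc m) ≤-refl)

sumℕ-if : ∀ m b (g : ℕ → ℕ) → sumℕ m (λ y → if b then g y else 0) ≡ (if b then sumℕ m g else 0)
sumℕ-if m true  g = refl
sumℕ-if m false g = sumℕ-zero m _ (λ _ _ → refl)

sumℕ-truncate : ∀ {x a} (g : ℕ → ℕ) → x ≤ a → (∀ y → x < y → g y ≡ 0) → sumℕ a g ≡ sumℕ x g
sumℕ-truncate {a = zero}  g z≤n _ = refl
sumℕ-truncate {a = suc a} g x≤1+a beyond with m≤n⇒m<n∨m≡n x≤1+a
... | inj₂ refl = refl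
... | inj₁ (s≤s x≤a) =
  trans (cong₂ _+_ (sumℕ-truncate g x≤a beyond) (beyond (suc a) (s≤s x≤a))) (+-identityʳ _)

sumℕ-top : ∀ m (h : ℕ → ℕ) → sumℕ m (λ y → if y ≡ᵇ m then h y else 0) ≡ h m
sumℕ-top zero    h = refl
sumℕ-top (suc m) h = cong₂ _+_
  (sumℕ-zero m _ (λ y y≤m → cong (λ t → if t then h y else 0) (≡ᵇ-≢ (<⇒≢ (s≤s y≤m)))))
  (cong (λ t → if t then h (suc m) else 0) (≡ᵇ-refl m))

sum-upTo : ∀ m (h : ℕ → ℕ) → sum (map h (upTo (suc m))) ≡ sumℕ m h
sum-upTo zero    h = +-identityʳ (h 0)
sum-upTo (suc m) h = begin
  sum (map h (upTo (suc (suc m))))          ≡⟨ cong (λ xs → sum (map h xs)) (sym (upTo-∷ʳ (suc m))) ⟩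
  sum (map h (upTo (suc m) ++ [ suc m ]))    ≡⟨ cong sum (map-++ h (upTo (suc m)) [ suc m ]) ⟩
  sum (map h (upTo (suc m)) ++ [ h (suc m) ]) ≡⟨ sum-++ (map h (upTo (suc m))) [ h (suc m) ] ⟩
  sum (map h (upTo (suc m))) + (h (suc m) + 0)
    ≡⟨ cong₂ _+_ (sum-upTo m h) (+-identityʳ (h (suc m))) ⟩
  sumℕ (suc m) h ∎

countB-++ : ∀ {A : Set} (P : A → Bool) xs ys → countB P (xs ++ ys) ≡ countB P xs + countB P ys
countB-++ P []       ys = refl
countB-++ P (x ∷ xs) ys with P x
... | true  = cong suc (countB-++ P xs ys)
... | false = countB-++ P xs ys

countB-map : ∀ {A B : Set} (P : B → Bool) (f : A → B) xs → countB P (map f xs) ≡ countB (λ x → P (f x)) xs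
countB-map P f []       = refl
countB-map P f (x ∷ xs) with P (f x)
... | true  = cong suc (countB-map P f xs)
... | false = countB-map P f xs

countB-concatMap : ∀ {A B : Set} (P : B → Bool) (f : A → List B) xs →
  countB P (concatMap f xs) ≡ sum (map (λ x → countB P (f x)) xs)
countB-concatMap P f []       = refl
countB-concatMap P f (x ∷ xs) =
  trans (countB-++ P (f x) (concatMap f xs)) (cong (λ n → countB P (f x) + n) (countB-concatMap P f xs))

countB-none : ∀ {A : Set} (xs : List A) → countB (λ _ → false) xs ≡ 0
countB-none []       = refl
countB-none (x ∷ xs) = countB-none xs

countB-∧ : ∀ {A : Set} b (P : A → Bool) xs → countB (λ x → b ∧ P x) xs ≡ (if b then countB P xs else 0)
countB-∧ true  P xs = refl
countB-∧ false P xs = countB-none xs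

countB-boundedLists : ∀ (P : List ℕ → Bool) a n →
  countB P (boundedLists a (suc n)) ≡ sumℕ a (λ x → countB (λ r → P (x ∷ r)) (boundedLists a n))
countB-boundedLists P a n = begin
  countB P (concatMap (λ x → map (x ∷_) (boundedLists a n)) (upTo (suc a)))
    ≡⟨ countB-concatMap P (λ x → map (x ∷_) (boundedLists a n)) (upTo (suc a)) ⟩
  sum (map (λ x → countB P (map (x ∷_) (boundedLists a n))) (upTo (suc a)))
    ≡⟨ sum-upTo a _ ⟩
  sumℕ a (λ x → countB P (map (x ∷_) (boundedLists a n)))
    ≡⟨ sumℕ-cong a (λ x _ → countB-map P (x ∷_) (boundedLists a n)) ⟩
  sumℕ a (λ x → countB (λ r → P (x ∷ r)) (boundedLists a n)) ∎

countB-boundedLists-cong : ∀ a n (P Q : List ℕ → Bool) → (∀ r → length r ≡ n → P r ≡ Q r) →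
  countB P (boundedLists a n) ≡ countB Q (boundedLists a n)
countB-boundedLists-cong a zero    P Q P≗Q = cong (λ t → if t then 1 else 0) (P≗Q [] refl)
countB-boundedLists-cong a (suc n) P Q P≗Q = begin
  countB P (boundedLists a (suc n))
    ≡⟨ countB-boundedLists P a n ⟩
  sumℕ a (λ x → countB (λ r → P (x ∷ r)) (boundedLists a n))
    ≡⟨ sumℕ-cong a (λ x _ → countB-boundedLists-cong a n _ _ (λ r len → P≗Q (x ∷ r) (cong suc len))) ⟩
  sumℕ a (λ x → countB (λ r → Q (x ∷ r)) (boundedLists a n))
    ≡⟨ countB-boundedLists Q a n ⟨
  countB Q (boundedLists a (suc n)) ∎

count : (List ℕ → Bool) → ℕ → ℕ → ℕ
count C i j = countB (λ π → C π ∧ (largestPart π ≡ᵇ i) ∧ (numParts π ≡ᵇ j)) (boundedLists i j)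

-- Once π₁ = i and ℓ(π) = j are fixed, the test Γ(π) = k is the constant test i + j − 1 = k.
gate-swap : ∀ c l n g g′ → (l ≡ true → n ≡ true → g ≡ g′) → c ∧ l ∧ n ∧ g ≡ g′ ∧ c ∧ l ∧ n
gate-swap false l     n     g g′ _ = sym (∧-zeroʳ g′)
gate-swap true  false n     g g′ _ = sym (∧-zeroʳ g′)
gate-swap true  true  false g g′ _ = sym (∧-zeroʳ g′)
gate-swap true  true  true  g g′ g≡ = trans (g≡ refl refl) (sym (∧-identityʳ g′))

genSeries-lift : ∀ C → genSeries C ≈ lift (count C)
genSeries-lift C i j k =
  cong +_ (trans (countB-boundedLists-cong i j _ _ (λ π _ → hook-test π))
                 (countB-∧ (i + j ∸ 1 ≡ᵇ k) _ (boundedLists i j)))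
  where
  hook-test : ∀ π → C π ∧ (largestPart π ≡ᵇ i) ∧ (numParts π ≡ᵇ j) ∧ (Γ π ≡ᵇ k)
                  ≡ (i + j ∸ 1 ≡ᵇ k) ∧ C π ∧ (largestPart π ≡ᵇ i) ∧ (numParts π ≡ᵇ j)
  hook-test π =
    gate-swap (C π) (largestPart π ≡ᵇ i) (numParts π ≡ᵇ j) (Γ π ≡ᵇ k) (i + j ∸ 1 ≡ᵇ k) λ π₁≡i ℓ≡j →
    cong (_≡ᵇ k) (cong₂ (λ p l → p + l ∸ 1) (≡ᵇ-sound (largestPart π) i π₁≡i) (≡ᵇ-sound (numParts π) j ℓ≡j))

isChain : (ℕ → Bool) → (ℕ → ℕ → Bool) → ℕ → List ℕ → Bool
isChain E R x []      = E x
isChain E R x (y ∷ r) = E x ∧ R y x ∧ isChain E R y r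

isChain-cong : ∀ {E E′ R R′} → (∀ x → E x ≡ E′ x) → (∀ y x → R y x ≡ R′ y x) →
  ∀ x r → isChain E R x r ≡ isChain E′ R′ x r
isChain-cong E≗E′ R≗R′ x []      = E≗E′ x
isChain-cong E≗E′ R≗R′ x (y ∷ r) =
  cong₂ _∧_ (E≗E′ x) (cong₂ _∧_ (R≗R′ y x) (isChain-cong E≗E′ R≗R′ y r))

isChain-∧ : ∀ E R E′ R′ x r →
  isChain E R x r ∧ isChain E′ R′ x r ≡ isChain (λ z → E z ∧ E′ z) (λ y z → R y z ∧ R′ y z) x r
isChain-∧ E R E′ R′ x []      = refl
isChain-∧ E R E′ R′ x (y ∷ r) = begin
  (E x ∧ R y x ∧ isChain E R y r) ∧ (E′ x ∧ R′ y x ∧ isChain E′ R′ y r)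
    ≡⟨ ∧-interchange (E x) _ (E′ x) _ ⟩
  (E x ∧ E′ x) ∧ (R y x ∧ isChain E R y r) ∧ (R′ y x ∧ isChain E′ R′ y r)
    ≡⟨ cong ((E x ∧ E′ x) ∧_) (∧-interchange (R y x) _ (R′ y x) _) ⟩
  (E x ∧ E′ x) ∧ (R y x ∧ R′ y x) ∧ (isChain E R y r ∧ isChain E′ R′ y r)
    ≡⟨ cong (λ t → (E x ∧ E′ x) ∧ (R y x ∧ R′ y x) ∧ t) (isChain-∧ E R E′ R′ y r) ⟩
  isChain (λ z → E z ∧ E′ z) (λ y z → R y z ∧ R′ y z) x (y ∷ r) ∎

allB-isChain : ∀ p x r → allB p (x ∷ r) ≡ isChain p (λ _ _ → true) x r
allB-isChain p x []      = ∧-identityʳ (p x)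
allB-isChain p x (y ∷ r) = cong (p x ∧_) (allB-isChain p y r)

nonincreasing-isChain : ∀ x r → nonincreasing (x ∷ r) ≡ isChain (λ _ → true) _≤ᵇ_ x r
nonincreasing-isChain x []      = refl
nonincreasing-isChain x (y ∷ r) = cong ((y ≤ᵇ x) ∧_) (nonincreasing-isChain y r)

strictlyDecreasing-isChain : ∀ x r → strictlyDecreasing (x ∷ r) ≡ isChain (λ _ → true) _<ᵇ_ x r
strictlyDecreasing-isChain x []      = refl
strictlyDecreasing-isChain x (y ∷ r) = cong ((y <ᵇ x) ∧_) (strictlyDecreasing-isChain y r)

module Chains (E : ℕ → Bool) (R : ℕ → ℕ → Bool) (R⇒≤ : ∀ {y x} → R y x ≡ true → y ≤ x) where

  chains : ℕ → ℕ → ℕ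
  chains x zero    = if E x then 1 else 0
  chains x (suc n) = if E x then sumℕ x (λ y → if R y x then chains y n else 0) else 0

  -- Its table: the number of chains with head (largest part) i and j entries.
  table : ℕ → ℕ → ℕ
  table i zero    = 0
  table i (suc n) = chains i n

  chains-absent : ∀ x n → E x ≡ false → chains x n ≡ 0
  chains-absent x zero    Ex≡false rewrite Ex≡false = refl
  chains-absent x (suc n) Ex≡false rewrite Ex≡false = refl

  chains-suc-all : ∀ x n → E x ≡ true → (∀ y → y ≤ x → R y x ≡ true) →
    chains x (suc n) ≡ sumℕ x (λ y → chains y n)
  chains-suc-all x n Ex≡true all rewrite Ex≡true =
    sumℕ-cong x (λ y y≤x → cong (λ t → if t then chains y n else 0) (all y y≤x))

  countB-chains : ∀ n {a x} → x ≤ a → countB (isChain E R x) (boundedLists a n) ≡ chains x n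
  countB-chains zero            x≤a = refl
  countB-chains (suc n) {a} {x} x≤a = begin
    countB (isChain E R x) (boundedLists a (suc n))
      ≡⟨ countB-boundedLists (isChain E R x) a n ⟩
    sumℕ a (λ y → countB (λ r → E x ∧ R y x ∧ isChain E R y r) (boundedLists a n))
      ≡⟨ sumℕ-cong a (λ y _ → trans (countB-∧ (E x) _ (boundedLists a n))
           (cong (λ m → if E x then m else 0) (countB-∧ (R y x) (isChain E R y) (boundedLists a n)))) ⟩
    sumℕ a (λ y → if E x then term y else 0)
      ≡⟨ sumℕ-if a (E x) term ⟩
    (if E x then sumℕ a term else 0)
      ≡⟨ cong (λ m → if E x then m else 0) (sumℕ-truncate term x≤a beyond) ⟩
    (if E x then sumℕ x term else 0)
      ≡⟨ cong (λ m → if E x then m else 0) (sumℕ-cong x (λ y y≤x →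
           cong (λ m → if R y x then m else 0) (countB-chains n (≤-trans y≤x x≤a)))) ⟩
    chains x (suc n) ∎
    where
    term : ℕ → ℕ
    term y = if R y x then countB (isChain E R y) (boundedLists a n) else 0
    beyond : ∀ y → x < y → term y ≡ 0
    beyond y x<y with R y x in Ryx
    ... | true  = ⊥-elim (<⇒≱ x<y (R⇒≤ Ryx))
    ... | false = refl

  largestPart-chain : ∀ x r → isChain E R x r ≡ true → largestPart (x ∷ r) ≡ x
  largestPart-chain x []      _     = ⊔-identityʳ x
  largestPart-chain x (y ∷ r) chain with ∧-true (E x) _ chain
  ... | _ , rest with ∧-true (R y x) _ rest
  ...   | Ryx , chain′ = trans (cong (x ⊔_) (largestPart-chain y r chain′)) (m≥n⇒m⊔n≡m (R⇒≤ Ryx))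

  count≗table : ∀ C → C [] ≡ false → (∀ x r → C (x ∷ r) ≡ isChain E R x r) →
    ∀ i j → count C i j ≡ table i j
  count≗table C C[] link i zero    rewrite C[] = refl
  count≗table C C[] link i (suc n) = begin
    countB (λ π → C π ∧ (largestPart π ≡ᵇ i) ∧ (numParts π ≡ᵇ suc n)) (boundedLists i (suc n))
      ≡⟨ countB-boundedLists _ i n ⟩
    sumℕ i (λ x → countB (λ r → C (x ∷ r) ∧ (largestPart (x ∷ r) ≡ᵇ i) ∧ (length r ≡ᵇ n))
                         (boundedLists i n))
      ≡⟨ sumℕ-cong i (λ x _ → trans (countB-boundedLists-cong i n _ _ (head-is-largest x))
                                     (countB-∧ (x ≡ᵇ i) (isChain E R x) (boundedLists i n))) ⟩
    sumℕ i (λ x → if x ≡ᵇ i then countB (isChain E R x) (boundedLists i n) else 0)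
      ≡⟨ sumℕ-top i _ ⟩
    countB (isChain E R i) (boundedLists i n)
      ≡⟨ countB-chains n ≤-refl ⟩
    chains i n ∎
    where
    head-is-largest : ∀ x r → length r ≡ n →
      C (x ∷ r) ∧ (largestPart (x ∷ r) ≡ᵇ i) ∧ (length r ≡ᵇ n) ≡ (x ≡ᵇ i) ∧ isChain E R x r
    head-is-largest x r len rewrite link x r | len | ≡ᵇ-refl n with isChain E R x r in chain
    ... | false = sym (∧-zeroʳ (x ≡ᵇ i))
    ... | true  rewrite largestPart-chain x r chain = refl

  generating-function : ∀ C a b c d → C [] ≡ false → (∀ x r → C (x ∷ r) ≡ isChain E R x r) →
    E 0 ≡ false → (∀ i j → RecurrenceAt a b c d table (suc i) (suc j)) →
    genSeries C ⊛ (mono 0 0 0 ⊖ (mono a b (a + b) ⊕ mono c d (c + d))) ≈ mono 1 1 1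
  generating-function C a b c d C[] link E0 interior =
    functional-equation (genSeries C) table a b c d G≈table refl
      (recurrence-from-interior {a} {b} {c} {d} axisˣ (λ _ → refl) interior)
    where
    G≈table : genSeries C ≈ lift table
    G≈table i j k = trans (genSeries-lift C i j k)
      (cong (λ m → + (if i + j ∸ 1 ≡ᵇ k then m else 0)) (count≗table C C[] link i j))
    axisˣ : ∀ j → table 0 j ≡ 0
    axisˣ zero    = refl
    axisˣ (suc n) = chains-absent 0 n E0

positive : ℕ → Bool
positive x = 1 ≤ᵇ x

odd : ℕ → Bool
odd x = (x % 2) ≡ᵇ 1

<ᵇ⇒≤ : ∀ {y x} → (y <ᵇ x) ≡ true → y ≤ x
<ᵇ⇒≤ {y} {x} y<x = <⇒≤ (<ᵇ⇒< y x (≡true⇒T y<x))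

unit-above : ∀ i n → unit i (suc (suc n)) ≡ 0
unit-above i n = cong (λ t → if t then 1 else 0) (∧-zeroʳ (i ≡ᵇ 1))

isPartition-chain : ∀ x r → isPartition (x ∷ r) ≡ isChain positive _≤ᵇ_ x r
isPartition-chain x r = begin
  allPositive (x ∷ r) ∧ nonincreasing (x ∷ r)
    ≡⟨ cong₂ _∧_ (allB-isChain positive x r) (nonincreasing-isChain x r) ⟩
  isChain positive (λ _ _ → true) x r ∧ isChain (λ _ → true) _≤ᵇ_ x r
    ≡⟨ isChain-∧ positive _ _ _≤ᵇ_ x r ⟩
  isChain (λ z → positive z ∧ true) _≤ᵇ_ x r
    ≡⟨ isChain-cong (λ z → ∧-identityʳ (positive z)) (λ _ _ → refl) x r ⟩
  isChain positive _≤ᵇ_ x r ∎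

module 𝒫 where
  open Chains positive _≤ᵇ_ ≤ᵇ-sound

  chains-suc : ∀ x n → chains x (suc n) ≡ sumℕ x (λ y → chains y n)
  chains-suc zero    n = sym (chains-absent 0 n refl)
  chains-suc (suc a) n = chains-suc-all (suc a) n refl (λ y → ≤ᵇ-complete)

  -- The largest part either repeats or exceeds all others.
  recurrence : ∀ a n → RecurrenceAt 1 0 0 1 table (suc a) (suc n)
  recurrence zero    zero    = refl
  recurrence (suc a) zero    = refl
  recurrence a       (suc n) = begin
    chains (suc a) (suc n)                      ≡⟨ chains-suc (suc a) n ⟩
    sumℕ a (λ y → chains y n) + chains (suc a) n ≡⟨ cong (_+ chains (suc a) n) (chains-suc a n) ⟨
    chains a (suc n) + chains (suc a) n          ≡⟨ +-identityʳ _ ⟨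
    chains a (suc n) + chains (suc a) n + 0
      ≡⟨ cong (λ u → chains a (suc n) + chains (suc a) n + u) (unit-above (suc a) n) ⟨
    chains a (suc n) + chains (suc a) n + unit (suc a) (suc (suc n)) ∎

  generating-function-𝒫 :
    genSeries isPartition ⊛ (mono 0 0 0 ⊖ (mono 1 0 1 ⊕ mono 0 1 1)) ≈ mono 1 1 1
  generating-function-𝒫 =
    generating-function isPartition 1 0 0 1 refl isPartition-chain refl recurrence

≤ᵇ∧<ᵇ : ∀ y x → (y ≤ᵇ x) ∧ (y <ᵇ x) ≡ (y <ᵇ x)
≤ᵇ∧<ᵇ y x with y <ᵇ x in y<x
... | true  = trans (∧-identityʳ (y ≤ᵇ x)) (≤ᵇ-complete (<ᵇ⇒≤ {y} {x} y<x))
... | false = ∧-zeroʳ (y ≤ᵇ x)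

isDistinctPartition-chain : ∀ x r → isDistinctPartition (x ∷ r) ≡ isChain positive _<ᵇ_ x r
isDistinctPartition-chain x r = begin
  isPartition (x ∷ r) ∧ strictlyDecreasing (x ∷ r)
    ≡⟨ cong₂ _∧_ (isPartition-chain x r) (strictlyDecreasing-isChain x r) ⟩
  isChain positive _≤ᵇ_ x r ∧ isChain (λ _ → true) _<ᵇ_ x r
    ≡⟨ isChain-∧ positive _≤ᵇ_ _ _<ᵇ_ x r ⟩
  isChain (λ z → positive z ∧ true) (λ y z → (y ≤ᵇ z) ∧ (y <ᵇ z)) x r
    ≡⟨ isChain-cong (λ z → ∧-identityʳ (positive z)) ≤ᵇ∧<ᵇ x r ⟩
  isChain positive _<ᵇ_ x r ∎

module 𝒟 where
  open Chains positive _<ᵇ_ <ᵇ⇒≤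

  chains-suc : ∀ a n → chains (suc a) (suc n) ≡ sumℕ a (λ y → chains y n)
  chains-suc a n = begin
    sumℕ a (λ y → if y <ᵇ suc a then chains y n else 0) + (if a <ᵇ a then chains (suc a) n else 0)
      ≡⟨ cong₂ _+_ (sumℕ-cong a (λ y y≤a → cong (λ t → if t then chains y n else 0)
                                               (T⇒≡true (<⇒<ᵇ (s≤s y≤a)))))
                   (cong (λ t → if t then chains (suc a) n else 0) (<ᵇ-irrefl a)) ⟩
    sumℕ a (λ y → chains y n) + 0
      ≡⟨ +-identityʳ _ ⟩
    sumℕ a (λ y → chains y n) ∎

  -- The largest part either exceeds the second by one or by more.
  recurrence : ∀ a n → RecurrenceAt 1 0 1 1 table (suc a) (suc n)
  recurrence zero    zero    = refl
  recurrence (suc a) zero    = refl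
  recurrence zero    (suc n) = trans (chains-suc 0 n) (sym (+-identityʳ _))
  recurrence (suc a) (suc n) = begin
    chains (suc (suc a)) (suc n)                ≡⟨ chains-suc (suc a) n ⟩
    sumℕ a (λ y → chains y n) + chains (suc a) n ≡⟨ cong (_+ chains (suc a) n) (chains-suc a n) ⟨
    chains (suc a) (suc n) + chains (suc a) n    ≡⟨ +-identityʳ _ ⟨
    chains (suc a) (suc n) + chains (suc a) n + 0
      ≡⟨ cong (λ u → chains (suc a) (suc n) + chains (suc a) n + u) (unit-above (suc (suc a)) n) ⟨
    chains (suc a) (suc n) + chains (suc a) n + unit (suc (suc a)) (suc (suc n)) ∎

  generating-function-𝒟 :
    genSeries isDistinctPartition ⊛ (mono 0 0 0 ⊖ (mono 1 0 1 ⊕ mono 1 1 2)) ≈ mono 1 1 1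
  generating-function-𝒟 =
    generating-function isDistinctPartition 1 0 1 1 refl isDistinctPartition-chain refl recurrence

odd-+2 : ∀ n → odd (2 + n) ≡ odd n
odd-+2 n = cong (_≡ᵇ 1) (trans (cong (_% 2) (+-comm 2 n)) ([m+n]%n≡m%n n 2))

odd-alternates : ∀ n → odd n ≡ true → odd (suc n) ≡ false
odd-alternates zero          ()
odd-alternates (suc zero)    _     = refl
odd-alternates (suc (suc n)) odd-n =
  trans (odd-+2 (suc n)) (odd-alternates n (trans (sym (odd-+2 n)) odd-n))

oddPart : ℕ → Bool
oddPart x = positive x ∧ odd x

oddPart-+2 : ∀ b → oddPart (2 + b) ≡ oddPart b
oddPart-+2 zero    = refl
oddPart-+2 (suc b) = odd-+2 (suc b)

oddPart-alternates : ∀ b → oddPart b ≡ true → oddPart (suc b) ≡ false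
oddPart-alternates zero    ()
oddPart-alternates (suc b) odd-b = odd-alternates (suc b) odd-b

isOddPartition-chain : ∀ x r → isOddPartition (x ∷ r) ≡ isChain oddPart _≤ᵇ_ x r
isOddPartition-chain x r = begin
  isPartition (x ∷ r) ∧ allB odd (x ∷ r)
    ≡⟨ cong₂ _∧_ (isPartition-chain x r) (allB-isChain odd x r) ⟩
  isChain positive _≤ᵇ_ x r ∧ isChain odd (λ _ _ → true) x r
    ≡⟨ isChain-∧ positive _≤ᵇ_ odd _ x r ⟩
  isChain oddPart (λ y z → (y ≤ᵇ z) ∧ true) x r
    ≡⟨ isChain-cong (λ _ → refl) (λ y z → ∧-identityʳ (y ≤ᵇ z)) x r ⟩
  isChain oddPart _≤ᵇ_ x r ∎

module 𝒪 where
  open Chains oddPart _≤ᵇ_ ≤ᵇ-sound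

  -- Below an odd part b+2 the parts that may follow are those ≤ b, and b+2 itself.
  chains-step : ∀ b m → chains (2 + b) (suc m) ≡ chains (2 + b) m + chains b (suc m)
  chains-step b m = by-parity (oddPart b) refl
    where
    by-parity : ∀ t → oddPart b ≡ t → chains (2 + b) (suc m) ≡ chains (2 + b) m + chains b (suc m)
    by-parity false b-even =
      trans (chains-absent (2 + b) (suc m) b+2-even)
            (sym (cong₂ _+_ (chains-absent (2 + b) m b+2-even) (chains-absent b (suc m) b-even)))
      where
      b+2-even : oddPart (2 + b) ≡ false
      b+2-even = trans (oddPart-+2 b) b-even
    by-parity true b-odd = begin
      chains (2 + b) (suc m)
        ≡⟨ chains-suc-all (2 + b) m (trans (oddPart-+2 b) b-odd) (λ _ → ≤ᵇ-complete) ⟩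
      sumℕ b (λ y → chains y m) + chains (suc b) m + chains (2 + b) m
        ≡⟨ cong₂ (λ u v → u + v + chains (2 + b) m)
                 (chains-suc-all b m b-odd (λ _ → ≤ᵇ-complete))
                 (sym (chains-absent (suc b) m (oddPart-alternates b b-odd))) ⟨
      chains b (suc m) + 0 + chains (2 + b) m
        ≡⟨ cong (_+ chains (2 + b) m) (+-identityʳ (chains b (suc m))) ⟩
      chains b (suc m) + chains (2 + b) m
        ≡⟨ +-comm (chains b (suc m)) (chains (2 + b) m) ⟩
      chains (2 + b) m + chains b (suc m) ∎

  -- Either the smallest part is 1 (remove it) or all parts are ≥ 3 (lower the largest by 2).
  recurrence : ∀ a n → RecurrenceAt 0 1 2 0 table (suc a) (suc n)
  recurrence zero    zero    = refl
  recurrence zero    (suc m) = trans (cong (_+ chains 1 m) (chains-absent 0 m refl))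
                                     (sym (trans (+-identityʳ _) (+-identityʳ _)))
  recurrence (suc b) zero    =
    trans (cong (λ t → if t then 1 else 0) (oddPart-+2 b)) (sym (+-identityʳ _))
  recurrence (suc b) (suc m) = trans (chains-step b m) (sym (+-identityʳ _))

  generating-function-𝒪 :
    genSeries isOddPartition ⊛ (mono 0 0 0 ⊖ (mono 0 1 1 ⊕ mono 2 0 2)) ≈ mono 1 1 1
  generating-function-𝒪 =
    generating-function isOddPartition 0 1 2 0 refl isOddPartition-chain refl recurrence

theorem2p3 :
    (genSeries isPartition ⊛ (mono 0 0 0 ⊖ (mono 1 0 1 ⊕ mono 0 1 1)) ≈ mono 1 1 1)
    × (genSeries isDistinctPartition ⊛ (mono 0 0 0 ⊖ (mono 1 0 1 ⊕ mono 1 1 2)) ≈ mono 1 1 1)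
    × (genSeries isOddPartition ⊛ (mono 0 0 0 ⊖ (mono 0 1 1 ⊕ mono 2 0 2)) ≈ mono 1 1 1)
theorem2p3 = 𝒫.generating-function-𝒫 , 𝒟.generating-function-𝒟 , 𝒪.generating-function-𝒪
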